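{- Let $h\in\frac12\mathbb{N}$ and let $\mathfrak m$ be a precubic unicellular map of type $h$. Then the number of edges of $\mathfrak m$ is at least $6h-1$, and it is odd if $h$ is an integer and even otherwise. Moreover, if $\mathfrak m$ has $2m+\mathbb{1}_{h\in\mathbb{N}}$ edges, then it has $m+1-3h-\frac12\mathbb{1}_{h\notin\mathbb{N}}$ non-root leaves (vertices of degree $1$ other than the root vertex).
   Context: A map is an embedding of a connected finite graph (loops and multiple edges allowed) into a compact connected surface with simply connected faces, up to homeomorphism; it is rooted by a distinguished half-edge with a distinguished side, whose vertex is the root vertex. A map is unicellular if it has one face; its type $h$ is defined by Euler characteristic $2-2h$ of the surface. A map is precubic if all vertices have degree $1$ or $3$ and the root vertex has degree $1$. -}

module Defs where

open import Data.Nat using (ℕ; zero; suc; _+_; _*_; _∸_; _%_; _/_)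
open import Data.Fin using (Fin; _≟_)
open import Data.List using (List; []; _∷_; length; filter)
open import Data.List.Membership.Propositional using (_∈_)
open import Data.Fin.Base using ()
open import Data.List.Base using ()
open import Data.Vec.Functional using ()
open import Data.Product using (_×_; Σ; _,_)
open import Function.Bundles using (_⇔_)
open import Function.Definitions using (Surjective)
open import Relation.Binary.PropositionalEquality using (_≡_; _≢_)
open import Relation.Nullary.Decidable using (_×-dec_; ¬?)
import Data.Nat as ℕ
open import Data.Sum using (_⊎_)

allFin : (n : ℕ) → List (Fin n)
allFin n = Data.List.Base.tabulate {n = n} (λ i → i)

data Reach {n : ℕ} (fs : List (Fin n → Fin n)) : Fin n → Fin n → Set where
  here : ∀ {x} → Reach fs x x
  step : ∀ {f x y} → f ∈ fs → Reach fs (f x) y → Reach fs x y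

-- "The group generated by fs has exactly k orbits on Fin n", witnessed
-- by a classifying map onto Fin k whose fibres are exactly the orbits.
record Orbits {n : ℕ} (fs : List (Fin n → Fin n)) (k : ℕ) : Set where
  field
    cls      : Fin n → Fin k
    cls-surj : ∀ i → Σ (Fin n) (λ x → cls x ≡ i)
    cls-orb  : ∀ x y → (cls x ≡ cls y) ⇔ Reach fs x y

fibreSize : ∀ {n k} → (Fin n → Fin k) → Fin k → ℕ
fibreSize {n} c i = length (filter (λ x → c x ≟ i) (allFin n))

-- General (possibly non-orientable) combinatorial map on the flag set Fin n:
-- α₀ (vertex-switch), α₁ (edge-switch), α₂ (face/side-switch) are
-- fixed-point-free involutions, α₀α₂ = α₂α₀ is fixed-point free, and
-- the monodromy group ⟨α₀,α₁,α₂⟩ acts transitively (connectedness).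
record Map (n : ℕ) : Set where
  field
    α₀ α₁ α₂ : Fin n → Fin n
    inv₀ : ∀ x → α₀ (α₀ x) ≡ x
    inv₁ : ∀ x → α₁ (α₁ x) ≡ x
    inv₂ : ∀ x → α₂ (α₂ x) ≡ x
    fpf₀ : ∀ x → α₀ x ≢ x
    fpf₁ : ∀ x → α₁ x ≢ x
    fpf₂ : ∀ x → α₂ x ≢ x
    comm₀₂ : ∀ x → α₀ (α₂ x) ≡ α₂ (α₀ x)
    fpf₀₂  : ∀ x → α₀ (α₂ x) ≢ x
    transitive : ∀ x y → Reach (α₀ ∷ α₁ ∷ α₂ ∷ []) x y

  -- vertices = orbits of ⟨α₁,α₂⟩, edges = orbits of ⟨α₀,α₂⟩,
  -- faces = orbits of ⟨α₀,α₁⟩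
  vGens eGens fGens : List (Fin n → Fin n)
  vGens = α₁ ∷ α₂ ∷ []
  eGens = α₀ ∷ α₂ ∷ []
  fGens = α₀ ∷ α₁ ∷ []

-- Degree of vertex i: each incident half-edge contributes two flags.
degree : ∀ {n V} → (Fin n → Fin V) → Fin V → ℕ
degree c i = fibreSize c i / 2

record Precubic {n V : ℕ} (c : Fin n → Fin V) (r : Fin n) : Set where
  field
    deg13   : ∀ i → (degree c i ≡ 1) ⊎ (degree c i ≡ 3)
    rootDeg : degree c (c r) ≡ 1

nonRootLeaves : ∀ {n V} → (Fin n → Fin V) → Fin n → ℕ
nonRootLeaves {n} {V} c r =
  length (filter (λ i → (degree c i ℕ.≟ 1) ×-dec ¬? (i ≟ c r)) (allFin V))

-- For g = 2h: indicator of h ∈ ℕ (g even) and of h ∉ ℕ (g odd).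
𝟙int : ℕ → ℕ
𝟙int g = 1 ∸ (g % 2)

𝟙half : ℕ → ℕ
𝟙half g = g % 2

-- Count flags. Each edge consists of four flags and each vertex of degree d of 2d
-- flags, so the degrees sum to 2E. In a precubic map all degrees are 3 except at the
-- L + 1 leaves (the root vertex and L others), so 2E + 2(L + 1) = 3V. With one face
-- Euler's formula reads V + 2h = E + 1, and eliminating V gives E + 1 = 2L + 6h, from
-- which the bound, the parity of E and the number of leaves are read off.
module Submission where

open import Defs
open import Data.Nat using (ℕ; _+_; _*_; _≤_; _%_)
open import Data.Fin using (Fin)
open import Data.Integer using (+_) renaming (_+_ to _+ℤ_; _-_ to _-ℤ_)
open import Data.Product using (_×_)
open import Relation.Binary.PropositionalEquality using (_≡_)

open import Data.Nat using (zero; suc; s≤s; _<?_; _∸_) renaming (_≟_ to _≟ℕ_)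
open import Data.Nat.Properties
  using (+-*-semiring; <-cmp; ≤-trans; ≤-reflexive; m≤n+m; <⇒≤pred; m∸n+n≡m; m∸[m∸n]≡n;
         +-comm; +-assoc; +-identityʳ; +-cancelʳ-≡; *-comm; *-assoc; *-identityˡ; *-identityʳ;
         *-distribˡ-+; *-distribʳ-+; *-cancelˡ-≡)
open import Data.Nat.Divisibility using (_∣_; divides)
open import Data.Nat.DivMod using (m*[n/m]≡n; %-distribˡ-+; [m+kn]%n≡m%n; m%n<n)
import Data.Nat.Tactic.RingSolver as ℕ-Solver
import Data.Integer.Tactic.RingSolver as ℤ-Solver
open import Data.Integer.Properties using (pos-+) renaming (+-injective to +-injectiveℤ)
open import Data.Fin using (zero; suc; toℕ) renaming (_≟_ to _≟ᶠ_)
open import Data.Fin.Properties using (toℕ-injective; suc-injective)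
open import Data.Fin.Permutation using (Permutation; permutation)
open import Data.List using (List; []; _∷_; length; filter; tabulate)
open import Data.List.Membership.Propositional using (_∈_)
open import Data.List.Relation.Unary.Any using (here; there)
open import Data.List.Relation.Unary.All using ([]; _∷_)
open import Data.List.Relation.Unary.All.Properties using (All¬⇒¬Any)
open import Data.List.Relation.Unary.Unique.Propositional using (Unique; []; _∷_)
open import Algebra.Properties.Semiring.Sum +-*-semiring
  using (sum; sum-cong-≗; ∑-distrib-+; ∑-comm; sum-permute; sum-replicate-zero; *-distribˡ-sum)
open import Data.Product using (_,_)
open import Data.Sum using (inj₁; inj₂)
open import Data.Empty using (⊥-elim)
open import Relation.Nullary using (Dec; yes; no; ¬_)
open import Relation.Nullary.Decidable using (_×-dec_; ¬?)
open import Relation.Unary using (Decidable)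
open import Relation.Binary.Definitions using (tri<; tri≈; tri>)
open import Relation.Binary.PropositionalEquality
  using (refl; sym; trans; cong; cong₂; subst; _≢_; module ≡-Reasoning)
open import Function using (_∘_; id)
open import Function.Bundles using (Equivalence)

open Equivalence using (to; from)

[_] : ∀ {p} {P : Set p} → Dec P → ℕ
[ yes _ ] = 1
[ no _ ] = 0

[]-yes : ∀ {p} {P : Set p} (P? : Dec P) → P → [ P? ] ≡ 1
[]-yes (yes _) _ = refl
[]-yes (no ¬p) p = ⊥-elim (¬p p)

[]-no : ∀ {p} {P : Set p} (P? : Dec P) → ¬ P → [ P? ] ≡ 0
[]-no (yes p) ¬p = ⊥-elim (¬p p)
[]-no (no _) _ = refl

[]-cong : ∀ {p q} {P : Set p} {Q : Set q} (P? : Dec P) (Q? : Dec Q) →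
          (P → Q) → (Q → P) → [ P? ] ≡ [ Q? ]
[]-cong (yes p) Q? f g = sym ([]-yes Q? (f p))
[]-cong (no ¬p) Q? f g = sym ([]-no Q? (¬p ∘ g))

[]-split : ∀ {p q} {P : Set p} {Q : Set q} (P? : Dec P) (Q? : Dec Q) →
           (P → Q) → [ Q? ] ≡ [ Q? ×-dec ¬? P? ] + [ P? ]
[]-split (yes p) (yes q) f = refl
[]-split (yes p) (no ¬q) f = ⊥-elim (¬q (f p))
[]-split (no ¬p) (yes q) f = refl
[]-split (no ¬p) (no ¬q) f = refl

[<]+[>]≡1 : ∀ {m n} → m ≢ n → [ m <? n ] + [ n <? m ] ≡ 1
[<]+[>]≡1 {m} {n} m≢n with <-cmp m n
... | tri< m<n _ n≮m = cong₂ _+_ ([]-yes (m <? n) m<n) ([]-no (n <? m) n≮m)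
... | tri≈ _ m≡n _ = ⊥-elim (m≢n m≡n)
... | tri> m≮n _ n<m = cong₂ _+_ ([]-no (m <? n) m≮n) ([]-yes (n <? m) n<m)

count : ∀ {n p} {P : Fin n → Set p} → Decidable P → ℕ
count P? = sum (λ x → [ P? x ])

length-filter-tabulate : ∀ {a p} {A : Set a} {P : A → Set p} (P? : Decidable P) {n} (f : Fin n → A) →
                         length (filter P? (tabulate f)) ≡ count (P? ∘ f)
length-filter-tabulate P? {zero} f = refl
length-filter-tabulate P? {suc n} f with P? (f zero)
... | yes _ = cong suc (length-filter-tabulate P? (f ∘ suc))
... | no _ = length-filter-tabulate P? (f ∘ suc)

sum-const : ∀ n k → sum {n} (λ _ → k) ≡ n * k
sum-const zero k = refl
sum-const (suc n) k = cong (_+_ k) (sum-const n k)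

count-≡ : ∀ {n} (a : Fin n) → count (_≟ᶠ a) ≡ 1
count-≡ {suc n} zero = cong suc (sum-replicate-zero n)
count-≡ {suc n} (suc a) =
  trans (sum-cong-≗ (λ x → []-cong (suc x ≟ᶠ suc a) (x ≟ᶠ a) suc-injective (cong suc)))
        (count-≡ a)

module _ {n : ℕ} where
  open import Data.List.Membership.DecPropositional (_≟ᶠ_ {n}) using (_∈?_)

  count-∈ : (xs : List (Fin n)) → Unique xs → count (_∈? xs) ≡ length xs
  count-∈ [] [] = sum-replicate-zero n
  count-∈ (y ∷ ys) (y∉ys ∷ ys-unique) = begin
    count (_∈? y ∷ ys)
      ≡⟨ sum-cong-≗ split ⟩
    sum (λ x → [ x ≟ᶠ y ] + [ x ∈? ys ])
      ≡⟨ ∑-distrib-+ (λ x → [ x ≟ᶠ y ]) (λ x → [ x ∈? ys ]) ⟩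
    count (_≟ᶠ y) + count (_∈? ys)
      ≡⟨ cong₂ _+_ (count-≡ y) (count-∈ ys ys-unique) ⟩
    suc (length ys)
      ∎
    where
    open ≡-Reasoning
    split : ∀ x → [ x ∈? y ∷ ys ] ≡ [ x ≟ᶠ y ] + [ x ∈? ys ]
    split x = split-on (x ≟ᶠ y)
      where
      split-on : (x≟y : Dec (x ≡ y)) → [ x ∈? y ∷ ys ] ≡ [ x≟y ] + [ x ∈? ys ]
      split-on (yes refl) = trans ([]-yes (x ∈? y ∷ ys) (here refl))
                                  (cong suc (sym ([]-no (x ∈? ys) (All¬⇒¬Any y∉ys))))
      split-on (no x≢y) = []-cong (x ∈? y ∷ ys) (x ∈? ys)
                                  (λ { (here x≡y) → ⊥-elim (x≢y x≡y) ; (there p) → p }) there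

fibreSize≡count : ∀ {n k} (c : Fin n → Fin k) i → fibreSize c i ≡ count (λ x → c x ≟ᶠ i)
fibreSize≡count c i = length-filter-tabulate (λ x → c x ≟ᶠ i) id

sum-fibreSize : ∀ {n k} (c : Fin n → Fin k) → sum (fibreSize c) ≡ n
sum-fibreSize {n} c = begin
  sum (fibreSize c)                    ≡⟨ sum-cong-≗ (fibreSize≡count c) ⟩
  sum (λ i → sum (λ x → [ c x ≟ᶠ i ])) ≡⟨ ∑-comm (λ i x → [ c x ≟ᶠ i ]) ⟩
  sum (λ x → sum (λ i → [ c x ≟ᶠ i ])) ≡⟨ sum-cong-≗ one-class ⟩
  sum {n} (λ _ → 1)                    ≡⟨ sum-const n 1 ⟩
  n * 1                                ≡⟨ *-identityʳ n ⟩
  n                                    ∎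
  where
  open ≡-Reasoning
  one-class : ∀ x → sum (λ i → [ c x ≟ᶠ i ]) ≡ 1
  one-class x = trans (sum-cong-≗ (λ i → []-cong (c x ≟ᶠ i) (i ≟ᶠ c x) sym sym)) (count-≡ (c x))

-- Pair each x with f x and keep the member of the pair with the smaller index.
sum-invariant-even : ∀ {n} (f : Fin n → Fin n) → (∀ x → f (f x) ≡ x) → (∀ x → f x ≢ x) →
                     (w : Fin n → ℕ) → (∀ x → w (f x) ≡ w x) → 2 ∣ sum w
sum-invariant-even {n} f involutive fixpoint-free w invariant =
  divides (sum lower) (begin
    sum w                             ≡⟨ sum-cong-≗ split ⟩
    sum (λ x → lower x + lower (f x)) ≡⟨ ∑-distrib-+ lower (lower ∘ f) ⟩
    sum lower + sum (lower ∘ f)       ≡⟨ cong (_+_ (sum lower)) (sum-permute lower π) ⟨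
    sum lower + sum lower             ≡⟨ cong (_+_ (sum lower)) (+-identityʳ (sum lower)) ⟨
    2 * sum lower                     ≡⟨ *-comm 2 (sum lower) ⟩
    sum lower * 2                     ∎)
  where
  open ≡-Reasoning
  π : Permutation n n
  π = permutation f f involutive involutive
  lower : Fin n → ℕ
  lower x = [ toℕ x <? toℕ (f x) ] * w x
  lower-f : ∀ x → lower (f x) ≡ [ toℕ (f x) <? toℕ x ] * w x
  lower-f x rewrite involutive x | invariant x = refl
  split : ∀ x → w x ≡ lower x + lower (f x)
  split x = begin
    w x
      ≡⟨ *-identityˡ (w x) ⟨
    1 * w x
      ≡⟨ cong (_* w x) ([<]+[>]≡1 (fixpoint-free x ∘ sym ∘ toℕ-injective)) ⟨
    ([ toℕ x <? toℕ (f x) ] + [ toℕ (f x) <? toℕ x ]) * w x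
      ≡⟨ *-distribʳ-+ (w x) [ toℕ x <? toℕ (f x) ] [ toℕ (f x) <? toℕ x ] ⟩
    lower x + [ toℕ (f x) <? toℕ x ] * w x
      ≡⟨ cong (_+_ (lower x)) (lower-f x) ⟨
    lower x + lower (f x)
      ∎

module _ {n : ℕ} (M : Map n) where
  open Map M
  open import Data.List.Membership.DecPropositional (_≟ᶠ_ {n}) using (_∈?_)

  edgeFlags : Fin n → List (Fin n)
  edgeFlags a = a ∷ α₀ a ∷ α₂ a ∷ α₀ (α₂ a) ∷ []

  edgeFlags-closed : ∀ {f a x} → f ∈ eGens → x ∈ edgeFlags a → f x ∈ edgeFlags a
  edgeFlags-closed (here refl) (here refl) = there (here refl)
  edgeFlags-closed {a = a} (here refl) (there (here refl)) = here (inv₀ a)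
  edgeFlags-closed (here refl) (there (there (here refl))) = there (there (there (here refl)))
  edgeFlags-closed {a = a} (here refl) (there (there (there (here refl)))) = there (there (here (inv₀ (α₂ a))))
  edgeFlags-closed (there (here refl)) (here refl) = there (there (here refl))
  edgeFlags-closed {a = a} (there (here refl)) (there (here refl)) = there (there (there (here (sym (comm₀₂ a)))))
  edgeFlags-closed {a = a} (there (here refl)) (there (there (here refl))) = here (inv₂ a)
  edgeFlags-closed {a = a} (there (here refl)) (there (there (there (here refl)))) =
    there (here (trans (sym (comm₀₂ (α₂ a))) (cong α₀ (inv₂ a))))

  Reach-preserves-edgeFlags : ∀ {a x y} → Reach eGens x y → x ∈ edgeFlags a → y ∈ edgeFlags a
  Reach-preserves-edgeFlags here x∈ = x∈
  Reach-preserves-edgeFlags (step f∈ r) x∈ = Reach-preserves-edgeFlags r (edgeFlags-closed f∈ x∈)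

  ∈-edgeFlags⇒Reach : ∀ {a x} → x ∈ edgeFlags a → Reach eGens a x
  ∈-edgeFlags⇒Reach (here refl) = here
  ∈-edgeFlags⇒Reach (there (here refl)) = step (here refl) here
  ∈-edgeFlags⇒Reach (there (there (here refl))) = step (there (here refl)) here
  ∈-edgeFlags⇒Reach (there (there (there (here refl)))) = step (there (here refl)) (step (here refl) here)

  α₀-injective : ∀ {x y} → α₀ x ≡ α₀ y → x ≡ y
  α₀-injective {x} {y} e = trans (sym (inv₀ x)) (trans (cong α₀ e) (inv₀ y))

  edgeFlags-unique : ∀ a → Unique (edgeFlags a)
  edgeFlags-unique a =
    (fpf₀ a ∘ sym ∷ fpf₂ a ∘ sym ∷ fpf₀₂ a ∘ sym ∷ []) ∷
    ((λ e → fpf₀₂ a (trans (cong α₀ (sym e)) (inv₀ a))) ∷ fpf₂ a ∘ sym ∘ α₀-injective ∷ []) ∷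
    (fpf₀ (α₂ a) ∘ sym ∷ []) ∷
    [] ∷
    []

  edge-fibreSize : ∀ {E} (eo : Orbits eGens E) i → fibreSize (Orbits.cls eo) i ≡ 4
  edge-fibreSize eo i with Orbits.cls-surj eo i
  ... | a , refl = begin
    fibreSize cls (cls a)         ≡⟨ fibreSize≡count cls (cls a) ⟩
    count (λ x → cls x ≟ᶠ cls a) ≡⟨ sum-cong-≗ same-indicator ⟩
    count (_∈? edgeFlags a)       ≡⟨ count-∈ (edgeFlags a) (edgeFlags-unique a) ⟩
    4                             ∎
    where
    open ≡-Reasoning
    open Orbits eo
    orbit⇒∈ : ∀ x → cls x ≡ cls a → x ∈ edgeFlags a
    orbit⇒∈ x e = Reach-preserves-edgeFlags (to (cls-orb a x) (sym e)) (here refl)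
    ∈⇒orbit : ∀ x → x ∈ edgeFlags a → cls x ≡ cls a
    ∈⇒orbit x x∈ = sym (from (cls-orb a x) (∈-edgeFlags⇒Reach x∈))
    same-indicator : ∀ x → [ cls x ≟ᶠ cls a ] ≡ [ x ∈? edgeFlags a ]
    same-indicator x = []-cong (cls x ≟ᶠ cls a) (x ∈? edgeFlags a) (orbit⇒∈ x) (∈⇒orbit x)

  vertex-fibreSize : ∀ {V} (vo : Orbits vGens V) i →
                     fibreSize (Orbits.cls vo) i ≡ 2 * degree (Orbits.cls vo) i
  vertex-fibreSize vo i = sym (m*[n/m]≡n (subst (2 ∣_) (sym (fibreSize≡count cls i)) even))
    where
    open Orbits vo
    cls-α₂ : ∀ x → cls (α₂ x) ≡ cls x
    cls-α₂ x = from (cls-orb (α₂ x) x)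
                    (step (there (here refl)) (subst (λ z → Reach vGens z x) (sym (inv₂ x)) here))
    even : 2 ∣ count (λ x → cls x ≟ᶠ i)
    even = sum-invariant-even α₂ inv₂ fpf₂ (λ x → [ cls x ≟ᶠ i ])
                              (λ x → cong (λ v → [ v ≟ᶠ i ]) (cls-α₂ x))

  handshake : ∀ {V E} (vo : Orbits vGens V) (eo : Orbits eGens E) →
              sum (degree (Orbits.cls vo)) ≡ 2 * E
  handshake {E = E} vo eo = *-cancelˡ-≡ _ _ 2 (begin
    2 * sum (degree cls)            ≡⟨ *-distribˡ-sum 2 (degree cls) ⟩
    sum (λ i → 2 * degree cls i)    ≡⟨ sum-cong-≗ (vertex-fibreSize vo) ⟨
    sum (fibreSize cls)             ≡⟨ sum-fibreSize cls ⟩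
    n                               ≡⟨ sum-fibreSize (Orbits.cls eo) ⟨
    sum (fibreSize (Orbits.cls eo)) ≡⟨ sum-cong-≗ (edge-fibreSize eo) ⟩
    sum {E} (λ _ → 4)               ≡⟨ sum-const E 4 ⟩
    E * 4                           ≡⟨ *-comm E 4 ⟩
    4 * E                           ≡⟨ *-assoc 2 2 E ⟩
    2 * (2 * E)                     ∎)
    where
    open ≡-Reasoning
    open Orbits vo

module _ {n V} {c : Fin n → Fin V} {r : Fin n} (precubic : Precubic c r) where
  open Precubic precubic

  leaf? : Decidable (λ i → degree c i ≡ 1)
  leaf? i = degree c i ≟ℕ 1

  nonRootLeaf? : Decidable (λ i → degree c i ≡ 1 × i ≢ c r)
  nonRootLeaf? i = leaf? i ×-dec ¬? (i ≟ᶠ c r)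

  count-leaves : count leaf? ≡ nonRootLeaves c r + 1
  count-leaves = begin
    count leaf?
      ≡⟨ sum-cong-≗ (λ i → []-split (i ≟ᶠ c r) (leaf? i) (λ { refl → rootDeg })) ⟩
    sum (λ i → [ nonRootLeaf? i ] + [ i ≟ᶠ c r ])
      ≡⟨ ∑-distrib-+ (λ i → [ nonRootLeaf? i ]) (λ i → [ i ≟ᶠ c r ]) ⟩
    count nonRootLeaf? + count (_≟ᶠ c r)
      ≡⟨ cong₂ _+_ (length-filter-tabulate nonRootLeaf? id) (sym (count-≡ (c r))) ⟨
    nonRootLeaves c r + 1
      ∎
    where open ≡-Reasoning

  sum-degree-precubic : sum (degree c) + 2 * (nonRootLeaves c r + 1) ≡ 3 * V
  sum-degree-precubic = begin
    sum (degree c) + 2 * (nonRootLeaves c r + 1)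
      ≡⟨ cong (λ k → sum (degree c) + 2 * k) count-leaves ⟨
    sum (degree c) + 2 * count leaf?
      ≡⟨ cong (_+_ (sum (degree c))) (*-distribˡ-sum 2 (λ i → [ leaf? i ])) ⟩
    sum (degree c) + sum (λ i → 2 * [ leaf? i ])
      ≡⟨ ∑-distrib-+ (degree c) (λ i → 2 * [ leaf? i ]) ⟨
    sum (λ i → degree c i + 2 * [ leaf? i ])
      ≡⟨ sum-cong-≗ degree+2*[leaf]≡3 ⟩
    sum {V} (λ _ → 3)
      ≡⟨ sum-const V 3 ⟩
    V * 3
      ≡⟨ *-comm V 3 ⟩
    3 * V
      ∎
    where
    open ≡-Reasoning
    degree+2*[leaf]≡3 : ∀ i → degree c i + 2 * [ leaf? i ] ≡ 3
    degree+2*[leaf]≡3 i with deg13 i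
    ... | inj₁ d≡1 rewrite d≡1 = refl
    ... | inj₂ d≡3 rewrite d≡3 = refl

euler-relation : ∀ V E g → (+ V) -ℤ (+ E) +ℤ (+ 1) ≡ (+ 2) -ℤ (+ g) → V + g ≡ E + 1
euler-relation V E g euler = +-injectiveℤ (begin
  + (V + g)                                       ≡⟨ pos-+ V g ⟩
  + V +ℤ + g                                      ≡⟨ regroup (+ V) (+ E) (+ g) (+ 1) ⟩
  (+ V -ℤ + E +ℤ + 1) +ℤ (+ E +ℤ + g -ℤ + 1)      ≡⟨ cong (_+ℤ (+ E +ℤ + g -ℤ + 1)) euler ⟩
  (+ 2 -ℤ + g) +ℤ (+ E +ℤ + g -ℤ + 1)             ≡⟨ cancel (+ 2) (+ E) (+ g) (+ 1) ⟩
  + E +ℤ + 1                                      ≡⟨ pos-+ E 1 ⟨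
  + (E + 1)                                       ∎)
  where
  open ≡-Reasoning
  regroup : ∀ v e g o → v +ℤ g ≡ (v -ℤ e +ℤ o) +ℤ (e +ℤ g -ℤ o)
  regroup = ℤ-Solver.solve-∀
  cancel : ∀ t e g o → (t -ℤ g) +ℤ (e +ℤ g -ℤ o) ≡ e +ℤ (t -ℤ o)
  cancel = ℤ-Solver.solve-∀

edges+1≡2*leaves+3*genus : ∀ V E g L D → V + g ≡ E + 1 → D ≡ 2 * E → D + 2 * (L + 1) ≡ 3 * V →
                          E + 1 ≡ 2 * L + 3 * g
edges+1≡2*leaves+3*genus V E g L D euler handshake degrees = +-cancelʳ-≡ (2 * E + 2) _ _ (begin
  (E + 1) + (2 * E + 2)            ≡⟨ triple E ⟩
  3 * (E + 1)                      ≡⟨ cong (3 *_) euler ⟨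
  3 * (V + g)                      ≡⟨ *-distribˡ-+ 3 V g ⟩
  3 * V + 3 * g                    ≡⟨ cong (_+ 3 * g) degrees ⟨
  D + 2 * (L + 1) + 3 * g          ≡⟨ cong (λ d → d + 2 * (L + 1) + 3 * g) handshake ⟩
  2 * E + 2 * (L + 1) + 3 * g      ≡⟨ regroup E L g ⟩
  (2 * L + 3 * g) + (2 * E + 2)    ∎)
  where
  open ≡-Reasoning
  triple : ∀ E → (E + 1) + (2 * E + 2) ≡ 3 * (E + 1)
  triple = ℕ-Solver.solve-∀
  regroup : ∀ E L g → 2 * E + 2 * (L + 1) + 3 * g ≡ (2 * L + 3 * g) + (2 * E + 2)
  regroup = ℕ-Solver.solve-∀

suc-%2 : ∀ m → suc m % 2 ≡ 1 ∸ m % 2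
suc-%2 m with m % 2 | m%n<n m 2 | %-distribˡ-+ 1 m 2
... | 0 | _ | eq = eq
... | 1 | _ | eq = eq
... | suc (suc _) | s≤s (s≤s ()) | _

𝟙int+𝟙half≡1 : ∀ g → 𝟙int g + 𝟙half g ≡ 1
𝟙int+𝟙half≡1 g = m∸n+n≡m (<⇒≤pred (m%n<n g 2))

module _ (g E L : ℕ) (edges : E + 1 ≡ 2 * L + 3 * g) where
  open ≡-Reasoning

  genus-bound : 3 * g ≤ E + 1
  genus-bound = ≤-trans (m≤n+m (3 * g) (2 * L)) (≤-reflexive (sym edges))

  edges-parity : E % 2 ≡ 𝟙int g
  edges-parity = begin
    E % 2                          ≡⟨ m∸[m∸n]≡n (<⇒≤pred (m%n<n E 2)) ⟨
    1 ∸ (1 ∸ E % 2)                ≡⟨ cong (1 ∸_) (suc-%2 E) ⟨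
    1 ∸ (suc E % 2)                ≡⟨ cong (λ k → 1 ∸ k % 2) (trans (+-comm 1 E) edges) ⟩
    1 ∸ ((2 * L + 3 * g) % 2)      ≡⟨ cong (λ k → 1 ∸ k % 2) (regroup L g) ⟩
    1 ∸ ((g + (L + g) * 2) % 2)    ≡⟨ cong (1 ∸_) ([m+kn]%n≡m%n g (L + g) 2) ⟩
    1 ∸ g % 2                      ∎
    where
    regroup : ∀ L g → 2 * L + 3 * g ≡ g + (L + g) * 2
    regroup = ℕ-Solver.solve-∀

  leaves-count : ∀ m → E ≡ 2 * m + 𝟙int g → 2 * L + 3 * g + 𝟙half g ≡ 2 * m + 2
  leaves-count m E≡ = begin
    2 * L + 3 * g + 𝟙half g           ≡⟨ cong (_+ 𝟙half g) edges ⟨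
    E + 1 + 𝟙half g                   ≡⟨ cong (λ e → e + 1 + 𝟙half g) E≡ ⟩
    2 * m + 𝟙int g + 1 + 𝟙half g      ≡⟨ shuffle m (𝟙int g) (𝟙half g) ⟩
    2 * m + 1 + (𝟙int g + 𝟙half g)    ≡⟨ cong (_+_ (2 * m + 1)) (𝟙int+𝟙half≡1 g) ⟩
    2 * m + 1 + 1                     ≡⟨ +-assoc (2 * m) 1 1 ⟩
    2 * m + 2                         ∎
    where
    shuffle : ∀ m a b → 2 * m + a + 1 + b ≡ 2 * m + 1 + (a + b)
    shuffle = ℕ-Solver.solve-∀

lemma3p1 : (g : ℕ) {n : ℕ} (M : Map n) (r : Fin n) (V E F : ℕ)
           (vo : Orbits (Map.vGens M) V) (eo : Orbits (Map.eGens M) E)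
           (fo : Orbits (Map.fGens M) F) →
           F ≡ 1 →
           (+ V) -ℤ (+ E) +ℤ (+ F) ≡ (+ 2) -ℤ (+ g) →
           Precubic (Orbits.cls vo) r →
           (3 * g ≤ E + 1)
           × (E % 2 ≡ 𝟙int g)
           × ((m : ℕ) → E ≡ 2 * m + 𝟙int g →
                2 * nonRootLeaves (Orbits.cls vo) r + 3 * g + 𝟙half g ≡ 2 * m + 2)
lemma3p1 g M r V E F vo eo fo refl euler precubic =
  genus-bound g E L edges , edges-parity g E L edges , leaves-count g E L edges
  where
  L : ℕ
  L = nonRootLeaves (Orbits.cls vo) r
  edges : E + 1 ≡ 2 * L + 3 * g
  edges = edges+1≡2*leaves+3*genus V E g L _
    (euler-relation V E g euler) (handshake M vo eo) (sum-degree-precubic precubic)
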